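{- Let $\mathbb{T}$ be a complete Elgot monad on a distributive category $\mathbf{C}$, $\Sigma$ a strong functor such that each $T(X+\Sigma(-))$ has a final coalgebra $\mathrm{out}_X:T_\Sigma X\to T(X+\Sigma T_\Sigma X)$, and equip $\mathbb{T}_\Sigma$ with its strong monad structure and its complete Elgot structure (see context). Let $\mathrm{ext}=\mathrm{out}^{ -1}\circ T\mathrm{inl}:T\to T_\Sigma$ and $\iota^{\mathbb{T}}_X=\mathrm{out}^{ -1}\circ\eta\circ\mathrm{inr}\circ\Sigma\eta^{\nu}:\Sigma X\to T_\Sigma X$. Then for every complete Elgot monad $\mathbb{S}$, every strong natural transformation $\upsilon:\Sigma\to S$ and every complete Elgot monad morphism $\sigma:\mathbb{T}\to\mathbb{S}$, there is a unique complete Elgot monad morphism $\xi:\mathbb{T}_\Sigma\to\mathbb{S}$ with $\xi\circ\mathrm{ext}=\sigma$ and $\xi\circ\iota^{\mathbb{T}}=\upsilon$. Specifically, $\xi_X=\zeta_X^{\dagger}$ where $\zeta_X=[\eta\circ\mathrm{inl},S\mathrm{inr}\circ\upsilon]^{*}\circ\sigma\circ\mathrm{out}:T_\Sigma X\to S(X+T_\Sigma X)$.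
   Context: $\mathbf{C}$ is distributive (finite products and coproducts, with inverse distributivity map $\mathrm{dist}:X\times(Y+Z)\to X\times Y+X\times Z$). A strong monad is a Kleisli triple $(T,\eta,(-)^{*})$ with strength $\tau$ satisfying the usual laws; a strong functor has a strength $\rho_{X,Y}:X\times\Sigma Y\to\Sigma(X\times Y)$ with the usual laws, and a strong natural transformation $\alpha:F\to G$ satisfies $\rho\circ(\mathrm{id}\times\alpha)=\alpha\circ\rho$. A complete Elgot monad is a strong monad with an operator assigning to every $f:X\to T(Y+X)$ a morphism $f^{\dagger}:X\to TY$ satisfying: unfolding $[\eta,f^{\dagger}]^{*}f=f^{\dagger}$; naturality $g^{*}f^{\dagger}=([T\mathrm{inl}\circ g,\eta\mathrm{inr}]^{*}f)^{\dagger}$; dinaturality $([\eta\mathrm{inl},h]^{*}g)^{\dagger}=[\eta,([\eta\mathrm{inl},g]^{*}h)^{\dagger}]^{*}g$ ($g:X\to T(Y+Z)$, $h:Z\to T(Y+X)$); codiagonal $(T[\mathrm{id},\mathrm{inr}]g)^{\dagger}=(g^{\dagger})^{\dagger}$ ($g:X\to T((Y+X)+X)$); uniformity: $f h=T(\mathrm{id}+h)g$ implies $f^{\dagger}h=g^{\dagger}$; strength compatibility $\tau(\mathrm{id}\times f^{\dagger})=(T\mathrm{dist}\circ\tau\circ(\mathrm{id}\times f))^{\dagger}$. A complete Elgot monad morphism $\xi:\mathbb{R}\to\mathbb{S}$ is a natural transformation with $\xi\eta=\eta$, $\xi f^{*}=(\xi f)^{*}\xi$, $\xi\tau=\tau(\mathrm{id}\times\xi)$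 and $(\xi g)^{\dagger}=\xi g^{\dagger}$. The strong monad $\mathbb{T}_\Sigma$: unit $\eta^{\nu}$ with $\mathrm{out}\circ\eta^{\nu}=\eta\circ\mathrm{inl}$; $f^{\ddagger}$ the unique solution of $\mathrm{out}\circ f^{\ddagger}=[\mathrm{out}\circ f,\eta\circ\mathrm{inr}\circ\Sigma f^{\ddagger}]^{*}\circ\mathrm{out}$; strength $\tau^{\nu}$ the unique solution of $\mathrm{out}\circ\tau^{\nu}=T(\mathrm{id}+\Sigma\tau^{\nu})\circ T((\mathrm{id}+\rho)\circ\mathrm{dist})\circ\tau\circ(\mathrm{id}\times\mathrm{out})$. Its complete Elgot structure is the unique one such that for $f:X\to T_\Sigma(Y+X)$, $g:X\to T(Y+X)$ with $\mathrm{out}\circ f=T\mathrm{inl}\circ g$ one has $\mathrm{out}\circ f^{\dagger}=T\mathrm{inl}\circ g^{\dagger}$. -}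

module Defs where

open import Level using (Level; _⊔_) renaming (suc to lsuc)
open import Relation.Binary using (Rel; IsEquivalence)

record Category (o ℓ e : Level) : Set (lsuc (o ⊔ ℓ ⊔ e)) where
  infixr 9 _∘_
  infix  4 _≈_
  infix  2 _⇒_
  field
    Obj      : Set o
    _⇒_      : Obj → Obj → Set ℓ
    _≈_      : ∀ {A B} → Rel (A ⇒ B) e
    id       : ∀ {A} → A ⇒ A
    _∘_      : ∀ {A B C} → B ⇒ C → A ⇒ B → A ⇒ C
    equiv    : ∀ {A B} → IsEquivalence (_≈_ {A} {B})
    ∘-resp-≈ : ∀ {A B C} {f g : B ⇒ C} {h i : A ⇒ B} → f ≈ g → h ≈ i → f ∘ h ≈ g ∘ i
    assoc    : ∀ {A B C D} {f : A ⇒ B} {g : B ⇒ C} {h : C ⇒ D} → (h ∘ g) ∘ f ≈ h ∘ (g ∘ f)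
    identityˡ : ∀ {A B} {f : A ⇒ B} → id ∘ f ≈ f
    identityʳ : ∀ {A B} {f : A ⇒ B} → f ∘ id ≈ f

module _ {o ℓ e} (C : Category o ℓ e) where
  open Category C

  record Cartesian : Set (o ⊔ ℓ ⊔ e) where
    infixr 7 _×_
    field
      ⊤        : Obj
      !        : ∀ {A} → A ⇒ ⊤
      !-unique : ∀ {A} (f : A ⇒ ⊤) → f ≈ !
      _×_      : Obj → Obj → Obj
      π₁       : ∀ {A B} → A × B ⇒ A
      π₂       : ∀ {A B} → A × B ⇒ B
      ⟨_,_⟩    : ∀ {A B X} → X ⇒ A → X ⇒ B → X ⇒ A × B
      project₁ : ∀ {A B X} {f : X ⇒ A} {g : X ⇒ B} → π₁ ∘ ⟨ f , g ⟩ ≈ f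
      project₂ : ∀ {A B X} {f : X ⇒ A} {g : X ⇒ B} → π₂ ∘ ⟨ f , g ⟩ ≈ g
      ⟨⟩-unique : ∀ {A B X} {f : X ⇒ A} {g : X ⇒ B} {h : X ⇒ A × B} →
                  π₁ ∘ h ≈ f → π₂ ∘ h ≈ g → h ≈ ⟨ f , g ⟩

  record Cocartesian : Set (o ⊔ ℓ ⊔ e) where
    infixr 6 _+_
    field
      ⊥        : Obj
      ¡        : ∀ {A} → ⊥ ⇒ A
      ¡-unique : ∀ {A} (f : ⊥ ⇒ A) → f ≈ ¡
      _+_      : Obj → Obj → Obj
      inl      : ∀ {A B} → A ⇒ A + B
      inr      : ∀ {A B} → B ⇒ A + B
      [_,_]    : ∀ {A B X} → A ⇒ X → B ⇒ X → A + B ⇒ X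
      inject₁  : ∀ {A B X} {f : A ⇒ X} {g : B ⇒ X} → [ f , g ] ∘ inl ≈ f
      inject₂  : ∀ {A B X} {f : A ⇒ X} {g : B ⇒ X} → [ f , g ] ∘ inr ≈ g
      []-unique : ∀ {A B X} {f : A ⇒ X} {g : B ⇒ X} {h : A + B ⇒ X} →
                  h ∘ inl ≈ f → h ∘ inr ≈ g → h ≈ [ f , g ]

module CartesianOps {o ℓ e} {C : Category o ℓ e} (P : Cartesian C) where
  open Category C
  open Cartesian P

  infixr 8 _⁂_
  _⁂_ : ∀ {A B A' B'} → A ⇒ A' → B ⇒ B' → A × B ⇒ A' × B'
  f ⁂ g = ⟨ f ∘ π₁ , g ∘ π₂ ⟩

  assocʳ : ∀ {A B D} → (A × B) × D ⇒ A × (B × D)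
  assocʳ = ⟨ π₁ ∘ π₁ , ⟨ π₂ ∘ π₁ , π₂ ⟩ ⟩

module CocartesianOps {o ℓ e} {C : Category o ℓ e} (K : Cocartesian C) where
  open Category C
  open Cocartesian K

  infixr 7 _+₁_
  _+₁_ : ∀ {A B A' B'} → A ⇒ A' → B ⇒ B' → A + B ⇒ A' + B'
  f +₁ g = [ inl ∘ f , inr ∘ g ]

record Distributive {o ℓ e} (C : Category o ℓ e) (P : Cartesian C) (K : Cocartesian C)
       : Set (o ⊔ ℓ ⊔ e) where
  open Category C
  open Cartesian P
  open Cocartesian K
  open CartesianOps P
  field
    dist : ∀ {X Y Z} → X × (Y + Z) ⇒ (X × Y) + (X × Z)
    dist-inverseˡ : ∀ {X Y Z} → dist {X} {Y} {Z} ∘ [ id ⁂ inl , id ⁂ inr ] ≈ id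
    dist-inverseʳ : ∀ {X Y Z} → [ id ⁂ inl , id ⁂ inr ] ∘ dist {X} {Y} {Z} ≈ id

record DistributiveCategory (o ℓ e : Level) : Set (lsuc (o ⊔ ℓ ⊔ e)) where
  field
    category     : Category o ℓ e
    cartesian    : Cartesian category
    cocartesian  : Cocartesian category
    distributive : Distributive category cartesian cocartesian

module Over {o ℓ e} (𝒟 : DistributiveCategory o ℓ e) where
  open DistributiveCategory 𝒟
  open Category category public
  open Cartesian cartesian public
  open Cocartesian cocartesian public
  open Distributive distributive public
  open CartesianOps cartesian public
  open CocartesianOps cocartesian public

  record StrongFunctor : Set (o ⊔ ℓ ⊔ e) where
    field
      F₀       : Obj → Obj
      F₁       : ∀ {A B} → A ⇒ B → F₀ A ⇒ F₀ B
      F-resp-≈ : ∀ {A B} {f g : A ⇒ B} → f ≈ g → F₁ f ≈ F₁ g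
      F-id     : ∀ {A} → F₁ (id {A}) ≈ id
      F-∘      : ∀ {A B D} {f : A ⇒ B} {g : B ⇒ D} → F₁ (g ∘ f) ≈ F₁ g ∘ F₁ f
      ρ        : ∀ {X Y} → X × F₀ Y ⇒ F₀ (X × Y)
      ρ-natural : ∀ {X X' Y Y'} {f : X ⇒ X'} {g : Y ⇒ Y'} →
                  ρ ∘ (f ⁂ F₁ g) ≈ F₁ (f ⁂ g) ∘ ρ
      ρ-unit   : ∀ {Y} → F₁ π₂ ∘ ρ {⊤} {Y} ≈ π₂
      ρ-assoc  : ∀ {X Y Z} → F₁ assocʳ ∘ ρ {X × Y} {Z} ≈ ρ ∘ (id ⁂ ρ) ∘ assocʳ

  record KleisliTriple (T : Obj → Obj) : Set (o ⊔ ℓ ⊔ e) where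
    infix 20 _*
    field
      η        : ∀ {X} → X ⇒ T X
      _*       : ∀ {X Y} → X ⇒ T Y → T X ⇒ T Y
      *-resp-≈ : ∀ {X Y} {f g : X ⇒ T Y} → f ≈ g → f * ≈ g *
      η*       : ∀ {X} → η {X} * ≈ id
      *η       : ∀ {X Y} {f : X ⇒ T Y} → f * ∘ η ≈ f
      *∘*      : ∀ {X Y Z} {f : X ⇒ T Y} {g : Y ⇒ T Z} → (g * ∘ f) * ≈ g * ∘ f *

    Tmap : ∀ {A B} → A ⇒ B → T A ⇒ T B
    Tmap f = (η ∘ f) *

  record StrongMonadOn (T : Obj → Obj) : Set (o ⊔ ℓ ⊔ e) where
    field
      kleisli : KleisliTriple T
    open KleisliTriple kleisli public
    field
      τ         : ∀ {X Y} → X × T Y ⇒ T (X × Y)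
      τ-natural : ∀ {X X' Y Y'} {f : X ⇒ X'} {g : Y ⇒ Y'} →
                  τ ∘ (f ⁂ Tmap g) ≈ Tmap (f ⁂ g) ∘ τ
      τ-unit    : ∀ {Y} → Tmap π₂ ∘ τ {⊤} {Y} ≈ π₂
      τ-assoc   : ∀ {X Y Z} → Tmap assocʳ ∘ τ {X × Y} {Z} ≈ τ ∘ (id ⁂ τ) ∘ assocʳ
      τ-η       : ∀ {X Y} → τ ∘ (id ⁂ η) ≈ η {X × Y}
      τ-*       : ∀ {X Y Z} {f : Y ⇒ T Z} →
                  τ ∘ (id {X} ⁂ f *) ≈ (τ ∘ (id ⁂ f)) * ∘ τ

  record CompleteElgotMonadOn (T : Obj → Obj) : Set (o ⊔ ℓ ⊔ e) where
    field
      strongMonad : StrongMonadOn T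
    open StrongMonadOn strongMonad public
    infix 20 _†
    field
      _†          : ∀ {X Y} → X ⇒ T (Y + X) → X ⇒ T Y
      †-resp-≈    : ∀ {X Y} {f g : X ⇒ T (Y + X)} → f ≈ g → f † ≈ g †
      unfold-law  : ∀ {X Y} {f : X ⇒ T (Y + X)} → [ η , f † ] * ∘ f ≈ f †
      naturality  : ∀ {X Y Z} {f : X ⇒ T (Y + X)} {g : Y ⇒ T Z} →
                    g * ∘ f † ≈ ([ Tmap inl ∘ g , η ∘ inr ] * ∘ f) †
      dinaturality : ∀ {X Y Z} {g : X ⇒ T (Y + Z)} {h : Z ⇒ T (Y + X)} →
                    ([ η ∘ inl , h ] * ∘ g) † ≈ [ η , ([ η ∘ inl , g ] * ∘ h) † ] * ∘ g
      codiagonal  : ∀ {X Y} {g : X ⇒ T ((Y + X) + X)} →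
                    (Tmap [ id , inr ] ∘ g) † ≈ (g †) †
      uniformity  : ∀ {X Y Z} {f : Z ⇒ T (Y + Z)} {g : X ⇒ T (Y + X)} {h : X ⇒ Z} →
                    f ∘ h ≈ Tmap (id +₁ h) ∘ g → f † ∘ h ≈ g †
      strength    : ∀ {X Y Z} {f : Y ⇒ T (Z + Y)} →
                    τ ∘ (id {X} ⁂ f †) ≈ (Tmap dist ∘ τ ∘ (id ⁂ f)) †

  record StrongNatTrans (Sig : StrongFunctor) {S₀ : Obj → Obj}
         (S : CompleteElgotMonadOn S₀) : Set (o ⊔ ℓ ⊔ e) where
    private
      module Sig = StrongFunctor Sig
      module S = CompleteElgotMonadOn S
    field
      α        : ∀ {X} → Sig.F₀ X ⇒ S₀ X
      natural  : ∀ {X Y} {f : X ⇒ Y} → α ∘ Sig.F₁ f ≈ S.Tmap f ∘ α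
      strong   : ∀ {X Y} → S.τ ∘ (id ⁂ α) ≈ α ∘ Sig.ρ {X} {Y}

  record ElgotMorphism {R₀ S₀ : Obj → Obj} (R : CompleteElgotMonadOn R₀)
         (S : CompleteElgotMonadOn S₀) : Set (o ⊔ ℓ ⊔ e) where
    private
      module R = CompleteElgotMonadOn R
      module S = CompleteElgotMonadOn S
    field
      ξ        : ∀ {X} → R₀ X ⇒ S₀ X
      natural  : ∀ {X Y} {f : X ⇒ Y} → ξ ∘ R.Tmap f ≈ S.Tmap f ∘ ξ
      unit     : ∀ {X} → ξ ∘ R.η ≈ S.η {X}
      bind     : ∀ {X Y} {f : X ⇒ R₀ Y} → ξ ∘ f R.* ≈ (ξ ∘ f) S.* ∘ ξ
      strength : ∀ {X Y} → ξ ∘ R.τ {X} {Y} ≈ S.τ ∘ (id ⁂ ξ)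
      dagger   : ∀ {X Y} {g : X ⇒ R₀ (Y + X)} → (ξ ∘ g) S.† ≈ ξ ∘ g R.†

  record FinalCoalgebras {T₀ : Obj → Obj} (T : CompleteElgotMonadOn T₀)
         (Sig : StrongFunctor) : Set (o ⊔ ℓ ⊔ e) where
    private
      module T = CompleteElgotMonadOn T
      module Sig = StrongFunctor Sig
    field
      TΣ      : Obj → Obj
      out     : ∀ {X} → TΣ X ⇒ T₀ (X + Sig.F₀ (TΣ X))
      unfold  : ∀ {X Y} → Y ⇒ T₀ (X + Sig.F₀ Y) → Y ⇒ TΣ X
      unfold-eq : ∀ {X Y} {c : Y ⇒ T₀ (X + Sig.F₀ Y)} →
                  out ∘ unfold c ≈ T.Tmap (id +₁ Sig.F₁ (unfold c)) ∘ c
      unfold-unique : ∀ {X Y} {c : Y ⇒ T₀ (X + Sig.F₀ Y)} {h : Y ⇒ TΣ X} →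
                  out ∘ h ≈ T.Tmap (id +₁ Sig.F₁ h) ∘ c → h ≈ unfold c

    -- the inverse of out (Lambek), obtained by finality
    out⁻¹ : ∀ {X} → T₀ (X + Sig.F₀ (TΣ X)) ⇒ TΣ X
    out⁻¹ = unfold (T.Tmap (id +₁ Sig.F₁ out))

  -- The complete Elgot monad structure M on TΣ is the one described in the
  -- paper: unit, Kleisli extension and strength are the unique solutions of
  -- the stated equations, and the Elgot iteration is characterised as stated.
  record IsCanonical {T₀ : Obj → Obj} {T : CompleteElgotMonadOn T₀}
         {Sig : StrongFunctor} (FC : FinalCoalgebras T Sig)
         (M : CompleteElgotMonadOn (FinalCoalgebras.TΣ FC)) : Set (o ⊔ ℓ ⊔ e) where
    private
      module T = CompleteElgotMonadOn T
      module Sig = StrongFunctor Sig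
      module M = CompleteElgotMonadOn M
    open FinalCoalgebras FC
    field
      unit-eq     : ∀ {X} → out ∘ M.η ≈ T.η ∘ inl {X}
      bind-eq     : ∀ {X Y} {f : X ⇒ TΣ Y} →
                    out ∘ f M.* ≈ [ out ∘ f , T.η ∘ inr ∘ Sig.F₁ (f M.*) ] T.* ∘ out
      strength-eq : ∀ {X Y} →
                    out ∘ M.τ {X} {Y} ≈ T.Tmap (id +₁ Sig.F₁ M.τ) ∘ T.Tmap ((id +₁ Sig.ρ) ∘ dist)
                                        ∘ T.τ ∘ (id ⁂ out)
      dagger-eq   : ∀ {X Y} {f : X ⇒ TΣ (Y + X)} {g : X ⇒ T₀ (Y + X)} →
                    out ∘ f ≈ T.Tmap inl ∘ g → out ∘ f M.† ≈ T.Tmap inl ∘ g T.†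

  module _ {T₀ : Obj → Obj} {T : CompleteElgotMonadOn T₀} {Sig : StrongFunctor}
           (FC : FinalCoalgebras T Sig)
           (M : CompleteElgotMonadOn (FinalCoalgebras.TΣ FC)) where
    private
      module T = CompleteElgotMonadOn T
      module Sig = StrongFunctor Sig
      module M = CompleteElgotMonadOn M
    open FinalCoalgebras FC

    ext : ∀ {X} → T₀ X ⇒ TΣ X
    ext = out⁻¹ ∘ T.Tmap inl

    ι : ∀ {X} → Sig.F₀ X ⇒ TΣ X
    ι = out⁻¹ ∘ T.η ∘ inr ∘ Sig.F₁ M.η

    ζ : ∀ {S₀ : Obj → Obj} {S : CompleteElgotMonadOn S₀} →
        StrongNatTrans Sig S → ElgotMorphism T S → ∀ {X} → TΣ X ⇒ S₀ (X + TΣ X)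
    ζ {S = S} υ σ =
      [ S.η ∘ inl , S.Tmap inr ∘ υ.α ] S.* ∘ σ.ξ ∘ out
      where
        module S = CompleteElgotMonadOn S
        module υ = StrongNatTrans υ
        module σ = ElgotMorphism σ

module Submission where

-- Existence.  ξ := ζ†, where ζ = [η ∘ inl , S inr ∘ υ]* ∘ σ ∘ out reads one
-- layer of a tree: the T-part is translated by σ, a leaf exits the loop and a
-- Σ-node is performed by υ, the loop continuing in the subtree.  Each law of a
-- complete Elgot monad morphism follows the same pattern: compute ζ after the
-- TΣ-operation in question (using the equations characterising the canonical
-- structure of TΣ), obtain a uniformity premise, and conclude with the
-- iteration laws of S (uniformity, codiagonal, naturality, strength).
--
-- Uniqueness.  Any ξ' with ξ' ∘ ext = σ and ξ' ∘ ι = υ satisfies ξ' ∘ r = ζ,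
-- where r = [η ∘ inl , ι ∘ Σ inr]* ∘ ext ∘ out re-expresses one layer of a
-- tree inside TΣ; finality of out gives r† = id, hence
-- ξ' = ξ' ∘ r† = (ξ' ∘ r)† = ζ† = ξ.

open import Defs
open import Data.Product using (Σ-syntax) renaming (_×_ to _∧_)
open import Data.Product using (_,_)
open import Relation.Binary using (Setoid; IsEquivalence)
import Relation.Binary.Reasoning.Setoid as SetoidReasoning

module Toolkit {o ℓ e} (𝒟 : DistributiveCategory o ℓ e) where
  open Over 𝒟 public

  module _ {A B : Obj} where
    open IsEquivalence (equiv {A} {B}) public
      using () renaming (refl to refl≈; sym to sym≈; trans to trans≈)

  hom-setoid : ∀ {A B} → Setoid ℓ e
  hom-setoid {A} {B} = record { Carrier = A ⇒ B ; _≈_ = _≈_ ; isEquivalence = equiv }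

  module _ {A B : Obj} where
    open SetoidReasoning (hom-setoid {A} {B}) public

  infixr 4 _⟩∘⟨_ refl⟩∘⟨_
  infixl 5 _⟩∘⟨refl
  _⟩∘⟨_ : ∀ {A B C} {f g : B ⇒ C} {h i : A ⇒ B} → f ≈ g → h ≈ i → f ∘ h ≈ g ∘ i
  _⟩∘⟨_ = ∘-resp-≈
  refl⟩∘⟨_ : ∀ {A B C} {f : B ⇒ C} {h i : A ⇒ B} → h ≈ i → f ∘ h ≈ f ∘ i
  refl⟩∘⟨ p = ∘-resp-≈ refl≈ p
  _⟩∘⟨refl : ∀ {A B C} {f g : B ⇒ C} {h : A ⇒ B} → f ≈ g → f ∘ h ≈ g ∘ h
  p ⟩∘⟨refl = ∘-resp-≈ p refl≈

  sym-assoc : ∀ {A B C D} {f : A ⇒ B} {g : B ⇒ C} {h : C ⇒ D} → h ∘ (g ∘ f) ≈ (h ∘ g) ∘ f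
  sym-assoc = sym≈ assoc

  pullˡ : ∀ {A B C D} {f : C ⇒ D} {g : B ⇒ C} {h : B ⇒ D} {k : A ⇒ B} →
          f ∘ g ≈ h → f ∘ (g ∘ k) ≈ h ∘ k
  pullˡ p = trans≈ sym-assoc (p ⟩∘⟨refl)

  pullʳ : ∀ {A B C D} {f : B ⇒ C} {g : A ⇒ B} {h : A ⇒ C} {k : C ⇒ D} →
          f ∘ g ≈ h → (k ∘ f) ∘ g ≈ k ∘ h
  pullʳ p = trans≈ assoc (refl⟩∘⟨ p)

  elimʳ : ∀ {A B} {f : A ⇒ B} {g : A ⇒ A} → g ≈ id → f ∘ g ≈ f
  elimʳ p = trans≈ (refl⟩∘⟨ p) identityʳ

  elimˡ : ∀ {A B} {f : A ⇒ B} {g : B ⇒ B} → g ≈ id → g ∘ f ≈ f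
  elimˡ p = trans≈ (p ⟩∘⟨refl) identityˡ

  []-cong₂ : ∀ {A B X} {f f' : A ⇒ X} {g g' : B ⇒ X} → f ≈ f' → g ≈ g' → [ f , g ] ≈ [ f' , g' ]
  []-cong₂ p q = []-unique (trans≈ inject₁ p) (trans≈ inject₂ q)

  +-η : ∀ {A B} → [ inl {A} {B} , inr ] ≈ id
  +-η = sym≈ ([]-unique identityˡ identityˡ)

  +-ext : ∀ {A B X} {h k : A + B ⇒ X} → h ∘ inl ≈ k ∘ inl → h ∘ inr ≈ k ∘ inr → h ≈ k
  +-ext p q = trans≈ ([]-unique p q) (sym≈ ([]-unique refl≈ refl≈))

  +-ext3 : ∀ {A B C X} {h k : (A + B) + C ⇒ X} →
           h ∘ inl ∘ inl ≈ k ∘ inl ∘ inl → h ∘ inl ∘ inr ≈ k ∘ inl ∘ inr → h ∘ inr ≈ k ∘ inr → h ≈ k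
  +-ext3 p q r = +-ext (+-ext (trans≈ assoc (trans≈ p sym-assoc)) (trans≈ assoc (trans≈ q sym-assoc))) r

  ∘[] : ∀ {A B X Y} {f : X ⇒ Y} {g : A ⇒ X} {h : B ⇒ X} → f ∘ [ g , h ] ≈ [ f ∘ g , f ∘ h ]
  ∘[] = []-unique (pullʳ inject₁) (pullʳ inject₂)

  +₁-cong₂ : ∀ {A B A' B'} {f f' : A ⇒ A'} {g g' : B ⇒ B'} → f ≈ f' → g ≈ g' → f +₁ g ≈ f' +₁ g'
  +₁-cong₂ p q = []-cong₂ (refl⟩∘⟨ p) (refl⟩∘⟨ q)

  []∘+₁ : ∀ {A B A' B' X} {f : A' ⇒ X} {g : B' ⇒ X} {h : A ⇒ A'} {k : B ⇒ B'} →
          [ f , g ] ∘ (h +₁ k) ≈ [ f ∘ h , g ∘ k ]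
  []∘+₁ = trans≈ ∘[] ([]-cong₂ (trans≈ sym-assoc (inject₁ ⟩∘⟨refl)) (trans≈ sym-assoc (inject₂ ⟩∘⟨refl)))

  +₁∘+₁ : ∀ {A B A' B' A'' B''} {f : A' ⇒ A''} {g : B' ⇒ B''} {h : A ⇒ A'} {k : B ⇒ B'} →
          (f +₁ g) ∘ (h +₁ k) ≈ (f ∘ h) +₁ (g ∘ k)
  +₁∘+₁ = trans≈ []∘+₁ ([]-cong₂ assoc assoc)

  id+id : ∀ {A B} → id {A} +₁ id {B} ≈ id
  id+id = trans≈ ([]-cong₂ identityʳ identityʳ) +-η

  -- (Y + X) + C → (Y + C) + X, moving the middle summand to the loop position
  loop-middle : ∀ {Y X C} → (Y + X) + C ⇒ (Y + C) + X
  loop-middle = [ [ inl ∘ inl , inr ] , inl ∘ inr ]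

  ⁂-cong₂ : ∀ {A B A' B'} {f f' : A ⇒ A'} {g g' : B ⇒ B'} → f ≈ f' → g ≈ g' → f ⁂ g ≈ f' ⁂ g'
  ⁂-cong₂ p q = ⟨⟩-unique (trans≈ project₁ (p ⟩∘⟨refl)) (trans≈ project₂ (q ⟩∘⟨refl))

  ⁂∘⁂ : ∀ {A B A' B' A'' B''} {f : A' ⇒ A''} {g : B' ⇒ B''} {h : A ⇒ A'} {k : B ⇒ B'} →
        (f ⁂ g) ∘ (h ⁂ k) ≈ (f ∘ h) ⁂ (g ∘ k)
  ⁂∘⁂ = ⟨⟩-unique (trans≈ sym-assoc (trans≈ (project₁ ⟩∘⟨refl) (trans≈ assoc (trans≈ (refl⟩∘⟨ project₁) sym-assoc))))
                   (trans≈ sym-assoc (trans≈ (project₂ ⟩∘⟨refl) (trans≈ assoc (trans≈ (refl⟩∘⟨ project₂) sym-assoc))))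

  id⁂∘ : ∀ {X A B C} {f : B ⇒ C} {g : A ⇒ B} → id {X} ⁂ (f ∘ g) ≈ (id ⁂ f) ∘ (id ⁂ g)
  id⁂∘ = sym≈ (trans≈ ⁂∘⁂ (⁂-cong₂ identityʳ refl≈))

  dist-inl : ∀ {X Y Z} → dist {X} {Y} {Z} ∘ (id ⁂ inl) ≈ inl
  dist-inl = trans≈ (refl⟩∘⟨ sym≈ inject₁) (trans≈ (pullˡ dist-inverseˡ) identityˡ)

  dist-inr : ∀ {X Y Z} → dist {X} {Y} {Z} ∘ (id ⁂ inr) ≈ inr
  dist-inr = trans≈ (refl⟩∘⟨ sym≈ inject₂) (trans≈ (pullˡ dist-inverseˡ) identityˡ)

  dist-ext : ∀ {X Y Z W} {h k : X × (Y + Z) ⇒ W} →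
             h ∘ (id ⁂ inl) ≈ k ∘ (id ⁂ inl) → h ∘ (id ⁂ inr) ≈ k ∘ (id ⁂ inr) → h ≈ k
  dist-ext {h = h} {k} p q = begin
      h                                          ≈⟨ sym≈ (elimʳ dist-inverseʳ) ⟩
      h ∘ [ id ⁂ inl , id ⁂ inr ] ∘ dist         ≈⟨ pullˡ ∘[] ⟩
      [ h ∘ (id ⁂ inl) , h ∘ (id ⁂ inr) ] ∘ dist ≈⟨ []-cong₂ p q ⟩∘⟨refl ⟩
      [ k ∘ (id ⁂ inl) , k ∘ (id ⁂ inr) ] ∘ dist ≈⟨ sym≈ (pullˡ ∘[]) ⟩
      k ∘ [ id ⁂ inl , id ⁂ inr ] ∘ dist         ≈⟨ elimʳ dist-inverseʳ ⟩
      k                                          ∎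

  module KleisliLaws {T₀ : Obj → Obj} (K : KleisliTriple T₀) where
    open KleisliTriple K

    Tmap-resp : ∀ {A B} {f g : A ⇒ B} → f ≈ g → Tmap f ≈ Tmap g
    Tmap-resp p = *-resp-≈ (refl⟩∘⟨ p)

    Tmap-id : ∀ {A} → Tmap (id {A}) ≈ id
    Tmap-id = trans≈ (*-resp-≈ identityʳ) η*

    *η' : ∀ {A X Y} {k : X ⇒ T₀ Y} {f : A ⇒ X} → k * ∘ η ∘ f ≈ k ∘ f
    *η' = pullˡ *η

    Tmap-η' : ∀ {A B C} {f : A ⇒ B} {g : C ⇒ A} → Tmap f ∘ η ∘ g ≈ η ∘ f ∘ g
    Tmap-η' = trans≈ *η' assoc

    *∘*∘ : ∀ {A X Y Z} {f : X ⇒ T₀ Y} {g : Y ⇒ T₀ Z} {h : A ⇒ T₀ X} → g * ∘ f * ∘ h ≈ (g * ∘ f) * ∘ h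
    *∘*∘ = pullˡ (sym≈ *∘*)

    *∘Tmap : ∀ {X Y Z} {k : Y ⇒ T₀ Z} {f : X ⇒ Y} → k * ∘ Tmap f ≈ (k ∘ f) *
    *∘Tmap = trans≈ (sym≈ *∘*) (*-resp-≈ *η')

    *∘Tmap∘ : ∀ {A X Y Z} {k : Y ⇒ T₀ Z} {f : X ⇒ Y} {h : A ⇒ T₀ X} → k * ∘ Tmap f ∘ h ≈ (k ∘ f) * ∘ h
    *∘Tmap∘ = pullˡ *∘Tmap

    Tmap∘*∘ : ∀ {A X Y Z} {k : X ⇒ T₀ Y} {f : Y ⇒ Z} {h : A ⇒ T₀ X} → Tmap f ∘ k * ∘ h ≈ (Tmap f ∘ k) * ∘ h
    Tmap∘*∘ = pullˡ (sym≈ *∘*)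

    Tmap∘Tmap : ∀ {A B C} {f : A ⇒ B} {g : B ⇒ C} → Tmap g ∘ Tmap f ≈ Tmap (g ∘ f)
    Tmap∘Tmap = trans≈ *∘Tmap (*-resp-≈ assoc)

    Tmap∘Tmap∘ : ∀ {X A B C} {f : A ⇒ B} {g : B ⇒ C} {h : X ⇒ T₀ A} → Tmap g ∘ Tmap f ∘ h ≈ Tmap (g ∘ f) ∘ h
    Tmap∘Tmap∘ = pullˡ Tmap∘Tmap

    []*∘Tmap-inl : ∀ {A B} {x : B ⇒ T₀ A} → [ η , x ] * ∘ Tmap inl ≈ id
    []*∘Tmap-inl = trans≈ *∘Tmap (trans≈ (*-resp-≈ inject₁) η*)

    Tmap+η-inl : ∀ {A B B'} {j : B ⇒ B'} → Tmap (id {A} +₁ j) ∘ η ∘ inl ≈ η ∘ inl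
    Tmap+η-inl = trans≈ Tmap-η' (refl⟩∘⟨ trans≈ inject₁ identityʳ)

    Tmap+∘Tmap-inr : ∀ {A A' B B' Z} {f : A ⇒ A'} {j : B ⇒ B'} {v : Z ⇒ T₀ B} →
                     Tmap (f +₁ j) ∘ Tmap inr ∘ v ≈ Tmap (inr ∘ j) ∘ v
    Tmap+∘Tmap-inr = trans≈ Tmap∘Tmap∘ (Tmap-resp inject₂ ⟩∘⟨refl)

  module ElgotLaws {R₀ : Obj → Obj} (R : CompleteElgotMonadOn R₀) where
    open CompleteElgotMonadOn R
    open KleisliLaws kleisli public

    †-Tmap : ∀ {X Y Z} {h : Y ⇒ Z} {f : X ⇒ R₀ (Y + X)} → Tmap h ∘ f † ≈ (Tmap (h +₁ id) ∘ f) †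
    †-Tmap {h = h} = trans≈ naturality (†-resp-≈ (*-resp-≈ pure ⟩∘⟨refl))
      where
        pure : [ Tmap inl ∘ η ∘ h , η ∘ inr ] ≈ η ∘ (h +₁ id)
        pure = trans≈ ([]-cong₂ Tmap-η' (sym≈ (refl⟩∘⟨ identityʳ))) (sym≈ ∘[])

    -- a loop on A + B whose body only ever jumps into B: unfold once, then
    -- iterate the body restricted to B
    †-enter-right : ∀ {A B Y} {r : A + B ⇒ R₀ (Y + B)} →
                    (Tmap (id +₁ inr) ∘ r) † ≈ [ η , (r ∘ inr) † ] * ∘ r
    †-enter-right {r = r} = begin
      D                                       ≈⟨ sym≈ unfold-law ⟩
      [ η , D ] * ∘ Tmap (id +₁ inr) ∘ r      ≈⟨ *∘Tmap∘ ⟩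
      ([ η , D ] ∘ (id +₁ inr)) * ∘ r         ≈⟨ *-resp-≈ []∘+₁ ⟩∘⟨refl ⟩
      [ η ∘ id , D ∘ inr ] * ∘ r              ≈⟨ *-resp-≈ ([]-cong₂ identityʳ (uniformity assoc)) ⟩∘⟨refl ⟩
      [ η , (r ∘ inr) † ] * ∘ r               ∎
      where
        D = (Tmap (id +₁ inr) ∘ r) †

    -- Bekič-style law: a loop a on A that may exit into a loop b on B.
    -- Iterating the joint system on A + B from A equals iterating a and then b.
    †-sequential : ∀ {A B Y} {a : A ⇒ R₀ ((Y + B) + A)} {b : B ⇒ R₀ (Y + B)} →
                   [ Tmap [ id +₁ inr , inr ∘ inl ] ∘ a , Tmap (id +₁ inr) ∘ b ] † ∘ inl
                   ≈ [ η , b † ] * ∘ a †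
    †-sequential {A} {B} {Y} {a} {b} = begin
      joint † ∘ inl                                        ≈⟨ †-resp-≈ joint-split ⟩∘⟨refl ⟩
      (Tmap [ id , inr ] ∘ split) † ∘ inl                  ≈⟨ codiagonal ⟩∘⟨refl ⟩
      (split †) † ∘ inl                                    ≈⟨ †-resp-≈ split† ⟩∘⟨refl ⟩
      (Tmap (id +₁ inr) ∘ [ a † , b ]) † ∘ inl             ≈⟨ †-enter-right ⟩∘⟨refl ⟩
      ([ η , ([ a † , b ] ∘ inr) † ] * ∘ [ a † , b ]) ∘ inl ≈⟨ pullʳ inject₁ ⟩
      [ η , ([ a † , b ] ∘ inr) † ] * ∘ a †                ≈⟨ *-resp-≈ ([]-cong₂ refl≈ (†-resp-≈ inject₂)) ⟩∘⟨refl ⟩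
      [ η , b † ] * ∘ a †                                  ∎
      where
        joint = [ Tmap [ id +₁ inr , inr ∘ inl ] ∘ a , Tmap (id +₁ inr) ∘ b ]
        -- the joint loop with the re-entries into A (inner loop) and the
        -- jumps into B (outer loop) separated
        split : A + B ⇒ R₀ ((Y + (A + B)) + (A + B))
        split = [ Tmap ((id +₁ inr) +₁ inl) ∘ a , Tmap (inl ∘ (id +₁ inr)) ∘ b ]
        joint-split : joint ≈ Tmap [ id , inr ] ∘ split
        joint-split = sym≈ (trans≈ ∘[] ([]-cong₂
               (trans≈ Tmap∘Tmap∘ (Tmap-resp (trans≈ []∘+₁ ([]-cong₂ identityˡ refl≈)) ⟩∘⟨refl))
               (trans≈ Tmap∘Tmap∘ (Tmap-resp (trans≈ (pullˡ inject₁) identityˡ) ⟩∘⟨refl))))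
        split-inl : split ∘ inl ≈ Tmap (id +₁ inl) ∘ Tmap ((id +₁ inr) +₁ id) ∘ a
        split-inl = trans≈ inject₁ (sym≈ (trans≈ Tmap∘Tmap∘
                  (Tmap-resp (trans≈ +₁∘+₁ (+₁-cong₂ identityˡ identityʳ)) ⟩∘⟨refl)))
        split† : split † ≈ Tmap (id +₁ inr) ∘ [ a † , b ]
        split† = +-ext
          (begin
             split † ∘ inl                          ≈⟨ uniformity split-inl ⟩
             (Tmap ((id +₁ inr) +₁ id) ∘ a) †       ≈⟨ sym≈ †-Tmap ⟩
             Tmap (id +₁ inr) ∘ a †                 ≈⟨ sym≈ (pullʳ inject₁) ⟩
             (Tmap (id +₁ inr) ∘ [ a † , b ]) ∘ inl ∎)
          (begin
             split † ∘ inr                                  ≈⟨ sym≈ unfold-law ⟩∘⟨refl ⟩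
             ([ η , split † ] * ∘ split) ∘ inr              ≈⟨ pullʳ inject₂ ⟩
             [ η , split † ] * ∘ Tmap (inl ∘ (id +₁ inr)) ∘ b ≈⟨ refl⟩∘⟨ sym≈ Tmap∘Tmap∘ ⟩
             [ η , split † ] * ∘ Tmap inl ∘ Tmap (id +₁ inr) ∘ b ≈⟨ trans≈ (pullˡ []*∘Tmap-inl) identityˡ ⟩
             Tmap (id +₁ inr) ∘ b                           ≈⟨ sym≈ (pullʳ inject₂) ⟩
             (Tmap (id +₁ inr) ∘ [ a † , b ]) ∘ inr         ∎)

    -- A loop whose body is p (itself looping on X, exiting with Y') followed
    -- by m (exiting or re-entering): iterate p, run m, and re-enter the whole
    -- loop if m does.
    †-staged : ∀ {X Y Y'} {p : X ⇒ R₀ (Y' + X)} {m : Y' ⇒ R₀ (Y + X)} →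
               ([ m , η ∘ inr ] * ∘ p) † ≈ ([ η , ([ m , η ∘ inr ] * ∘ p) † ] * ∘ m) * ∘ p †
    †-staged {X} {Y} {Y'} {p} {m} = begin
      q †                                               ≈⟨ q†≈ ⟩
      (m * ∘ p †) †                                     ≈⟨ sym≈ unfold-law ⟩
      [ η , (m * ∘ p †) † ] * ∘ m * ∘ p †               ≈⟨ *∘*∘ ⟩
      ([ η , (m * ∘ p †) † ] * ∘ m) * ∘ p †             ≈⟨ *-resp-≈ (*-resp-≈ ([]-cong₂ refl≈ (sym≈ q†≈)) ⟩∘⟨refl) ⟩∘⟨refl ⟩
      ([ η , q † ] * ∘ m) * ∘ p †                       ∎
      where
        q = [ m , η ∘ inr ] * ∘ p
        -- q is the codiagonal of the loop "p, then m" with two loop exits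
        q-codiagonal : q ≈ Tmap [ id , inr ] ∘ [ Tmap inl ∘ m , η ∘ inr ] * ∘ p
        q-codiagonal = sym≈ (trans≈ Tmap∘*∘ (*-resp-≈ (trans≈ ∘[] ([]-cong₂
               (trans≈ Tmap∘Tmap∘ (trans≈ (Tmap-resp inject₁ ⟩∘⟨refl) (elimˡ Tmap-id)))
               (trans≈ Tmap-η' (refl⟩∘⟨ inject₂)))) ⟩∘⟨refl))
        q†≈ : q † ≈ (m * ∘ p †) †
        q†≈ = trans≈ (†-resp-≈ q-codiagonal) (trans≈ codiagonal (†-resp-≈ (sym≈ naturality)))

    -- A loop u on P which, on reaching X, jumps to the state x.  Resolving
    -- these jumps inside the body, by running the loop u ∘ x (with X as loop
    -- state) until it leaves X, does not change the iteration.
    †-resolve-inner-loop : ∀ {P X Y C} {u : P ⇒ R₀ ((Y + X) + C)} {v : C ⇒ R₀ P} {x : X ⇒ P} →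
      ([ [ η ∘ inl , [ η ∘ inl , Tmap inr ∘ v ] * ∘ (Tmap loop-middle ∘ u ∘ x) † ] , Tmap inr ∘ v ] * ∘ u) †
      ≈ ([ [ η ∘ inl , η ∘ inr ∘ x ] , Tmap inr ∘ v ] * ∘ u) †
    †-resolve-inner-loop {P} {X} {Y} {C} {u} {v} {x} = begin
        resolved †                                    ≈⟨ sym≈ (uniformity F₀†-inl) ⟩
        (F₀ †) † ∘ inl                                ≈⟨ sym≈ codiagonal ⟩∘⟨refl ⟩
        (Tmap [ id , inr ] ∘ F₀) † ∘ inl              ≈⟨ sym≈ (†-resp-≈ F-split) ⟩∘⟨refl ⟩
        F † ∘ inl                                     ≈⟨ sym≈ (uniformity jumping-collapse) ⟩∘⟨refl ⟩
        (jumping † ∘ [ id , x ]) ∘ inl                ≈⟨ pullʳ inject₁ ⟩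
        jumping † ∘ id                                ≈⟨ identityʳ ⟩
        jumping †                                     ∎
      where
        exits : Y + C ⇒ R₀ (Y + P)
        exits = [ η ∘ inl , Tmap inr ∘ v ]
        inner : X ⇒ R₀ (Y + P)
        inner = exits * ∘ (Tmap loop-middle ∘ u ∘ x) †
        resolved jumping : P ⇒ R₀ (Y + P)
        resolved = [ [ η ∘ inl , inner ] , Tmap inr ∘ v ] * ∘ u
        jumping = [ [ η ∘ inl , η ∘ inr ∘ x ] , Tmap inr ∘ v ] * ∘ u

        -- the loop on P + X that records a jump to X as the state X
        Φ : (Y + X) + C ⇒ R₀ (Y + (P + X))
        Φ = [ [ η ∘ inl , η ∘ inr ∘ inr ] , Tmap (inr ∘ inl) ∘ v ]
        F : P + X ⇒ R₀ (Y + (P + X))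
        F = [ Φ * ∘ u , Φ * ∘ u ∘ x ]
        collapse : Y + (P + X) ⇒ Y + P
        collapse = id +₁ [ id , x ]
        collapse-Φ : Tmap collapse ∘ Φ ≈ [ [ η ∘ inl , η ∘ inr ∘ x ] , Tmap inr ∘ v ]
        collapse-Φ = trans≈ ∘[] ([]-cong₂ (trans≈ ∘[] ([]-cong₂ Tmap+η-inl
                (trans≈ Tmap-η' (refl⟩∘⟨ trans≈ (pullˡ inject₂) (trans≈ assoc (refl⟩∘⟨ inject₂))))))
                (trans≈ Tmap∘Tmap∘ (Tmap-resp (trans≈ (pullˡ inject₂)
                  (trans≈ assoc (trans≈ (refl⟩∘⟨ inject₁) identityʳ))) ⟩∘⟨refl)))
        jumping-collapse : jumping ∘ [ id , x ] ≈ Tmap collapse ∘ F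
        jumping-collapse = +-ext
          (trans≈ (pullʳ inject₁) (trans≈ identityʳ
            (sym≈ (trans≈ (pullʳ inject₁) (trans≈ Tmap∘*∘ (*-resp-≈ collapse-Φ ⟩∘⟨refl))))))
          (trans≈ (pullʳ inject₂) (trans≈ assoc
            (sym≈ (trans≈ (pullʳ inject₂) (trans≈ Tmap∘*∘ (*-resp-≈ collapse-Φ ⟩∘⟨refl))))))

        -- F with the entries into X separated as a second loop exit
        Φ₀ : (Y + X) + C ⇒ R₀ ((Y + (P + X)) + (P + X))
        Φ₀ = [ [ η ∘ inl ∘ inl , η ∘ inr ∘ inr ] , Tmap (inl ∘ inr ∘ inl) ∘ v ]
        F₀ : P + X ⇒ R₀ ((Y + (P + X)) + (P + X))
        F₀ = [ Φ₀ * ∘ u , Φ₀ * ∘ u ∘ x ]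
        codiagonal-Φ₀ : Tmap [ id , inr ] ∘ Φ₀ ≈ Φ
        codiagonal-Φ₀ = trans≈ ∘[] ([]-cong₂ (trans≈ ∘[] ([]-cong₂
                (trans≈ Tmap-η' (refl⟩∘⟨ trans≈ (pullˡ inject₁) identityˡ))
                (trans≈ Tmap-η' (refl⟩∘⟨ pullˡ inject₂))))
                (trans≈ Tmap∘Tmap∘ (Tmap-resp (trans≈ (pullˡ inject₁) identityˡ) ⟩∘⟨refl)))
        F-split : F ≈ Tmap [ id , inr ] ∘ F₀
        F-split = sym≈ (trans≈ ∘[] ([]-cong₂ (trans≈ Tmap∘*∘ (*-resp-≈ codiagonal-Φ₀ ⟩∘⟨refl))
                                            (trans≈ Tmap∘*∘ (*-resp-≈ codiagonal-Φ₀ ⟩∘⟨refl))))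

        exits' : Y + C ⇒ R₀ (Y + (P + X))
        exits' = [ η ∘ inl , Tmap (inr ∘ inl) ∘ v ]
        relabel-exits : Tmap (id +₁ inl) ∘ exits ≈ exits'
        relabel-exits = trans≈ ∘[] ([]-cong₂ Tmap+η-inl Tmap+∘Tmap-inr)

        F₀†-inr : F₀ † ∘ inr ≈ exits' * ∘ (Tmap loop-middle ∘ u ∘ x) †
        F₀†-inr = trans≈ (uniformity F₀-inr) (sym≈ naturality)
          where
            reenter : (Y + C) + X ⇒ R₀ ((Y + (P + X)) + (P + X))
            reenter = Tmap (id +₁ inr) ∘ [ Tmap inl ∘ exits' , η ∘ inr ]
            layout-exit : reenter ∘ loop-middle ∘ inl ∘ inl ≈ η ∘ inl ∘ inl
            layout-exit = trans≈ (refl⟩∘⟨ trans≈ (pullˡ inject₁) inject₁) (trans≈ (pullʳ (pullˡ inject₁))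
                (trans≈ (refl⟩∘⟨ pullʳ inject₁) (trans≈ Tmap∘Tmap∘ (trans≈ Tmap-η'
                  (refl⟩∘⟨ (trans≈ inject₁ identityʳ ⟩∘⟨refl))))))
            layout-loop : reenter ∘ loop-middle ∘ inl ∘ inr ≈ η ∘ inr ∘ inr
            layout-loop = trans≈ (refl⟩∘⟨ trans≈ (pullˡ inject₁) inject₂) (trans≈ (pullʳ inject₂)
                (trans≈ Tmap-η' (refl⟩∘⟨ inject₂)))
            layout-node : (reenter ∘ loop-middle) ∘ inr ≈ Tmap (inl ∘ inr ∘ inl) ∘ v
            layout-node = trans≈ (pullʳ inject₂) (trans≈ (pullʳ (pullˡ inject₁)) (trans≈ (refl⟩∘⟨ pullʳ inject₂)
                (trans≈ (refl⟩∘⟨ Tmap∘Tmap∘) (trans≈ Tmap∘Tmap∘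
                  (Tmap-resp (trans≈ (pullˡ inject₁) (trans≈ assoc (refl⟩∘⟨ identityˡ))) ⟩∘⟨refl)))))
            layout : reenter ∘ loop-middle ≈ Φ₀
            layout = []-unique ([]-unique (trans≈ (trans≈ assoc assoc) layout-exit)
                                          (trans≈ (trans≈ assoc assoc) layout-loop)) layout-node
            F₀-inr : F₀ ∘ inr ≈ Tmap (id +₁ inr) ∘ [ Tmap inl ∘ exits' , η ∘ inr ] * ∘ Tmap loop-middle ∘ u ∘ x
            F₀-inr = trans≈ inject₂ (sym≈ (trans≈ Tmap∘*∘ (trans≈ *∘Tmap∘ (*-resp-≈ layout ⟩∘⟨refl))))

        F₀†-inl : F₀ † ∘ inl ≈ Tmap (id +₁ inl) ∘ resolved
        F₀†-inl = begin
          F₀ † ∘ inl                                  ≈⟨ sym≈ unfold-law ⟩∘⟨refl ⟩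
          ([ η , F₀ † ] * ∘ F₀) ∘ inl                 ≈⟨ pullʳ inject₁ ⟩
          [ η , F₀ † ] * ∘ Φ₀ * ∘ u                   ≈⟨ *∘*∘ ⟩
          ([ η , F₀ † ] * ∘ Φ₀) * ∘ u                 ≈⟨ *-resp-≈ unfolded ⟩∘⟨refl ⟩
          [ [ η ∘ inl , Tmap (id +₁ inl) ∘ inner ] , Tmap (inr ∘ inl) ∘ v ] * ∘ u
                                                       ≈⟨ sym≈ (trans≈ Tmap∘*∘ (*-resp-≈ relabel ⟩∘⟨refl)) ⟩
          Tmap (id +₁ inl) ∘ resolved                 ∎
          where
            relabel-inner : Tmap (id +₁ inl) ∘ inner ≈ exits' * ∘ (Tmap loop-middle ∘ u ∘ x) †
            relabel-inner = trans≈ Tmap∘*∘ (*-resp-≈ relabel-exits ⟩∘⟨refl)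
            unfolded : [ η , F₀ † ] * ∘ Φ₀ ≈ [ [ η ∘ inl , Tmap (id +₁ inl) ∘ inner ] , Tmap (inr ∘ inl) ∘ v ]
            unfolded = trans≈ ∘[] ([]-cong₂ (trans≈ ∘[] ([]-cong₂
                (trans≈ *η' (pullˡ inject₁))
                (trans≈ *η' (trans≈ (pullˡ inject₂) (trans≈ F₀†-inr (sym≈ relabel-inner))))))
                (trans≈ *∘Tmap∘ (*-resp-≈ (pullˡ inject₁) ⟩∘⟨refl)))
            relabel : Tmap (id +₁ inl) ∘ [ [ η ∘ inl , inner ] , Tmap inr ∘ v ]
                      ≈ [ [ η ∘ inl , Tmap (id +₁ inl) ∘ inner ] , Tmap (inr ∘ inl) ∘ v ]
            relabel = trans≈ ∘[] ([]-cong₂ (trans≈ ∘[] ([]-cong₂ Tmap+η-inl refl≈)) Tmap+∘Tmap-inr)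

module Theory {o ℓ e} (𝒟 : DistributiveCategory o ℓ e) where
  open Toolkit 𝒟

  module Canonical {T₀ : Obj → Obj} (T : CompleteElgotMonadOn T₀) (Sig : StrongFunctor)
                   (FC : FinalCoalgebras T Sig) (M : CompleteElgotMonadOn (FinalCoalgebras.TΣ FC))
                   (can : IsCanonical FC M) where
    module T = CompleteElgotMonadOn T
    module TL = ElgotLaws T
    module M = CompleteElgotMonadOn M
    module ML = ElgotLaws M
    module Sg = StrongFunctor Sig
    open Sg public using (F₀; F₁)
    open FinalCoalgebras FC public
    open IsCanonical can public

    Tid+F∘ : ∀ {X A B C} {f : B ⇒ C} {g : A ⇒ B} →
             T.Tmap (id {X} +₁ F₁ f) ∘ T.Tmap (id +₁ F₁ g) ≈ T.Tmap (id +₁ F₁ (f ∘ g))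
    Tid+F∘ = trans≈ TL.Tmap∘Tmap (TL.Tmap-resp (trans≈ +₁∘+₁ (+₁-cong₂ identityˡ (sym≈ Sg.F-∘))))

    Tid+Fid : ∀ {X A} → T.Tmap (id {X} +₁ F₁ (id {A})) ≈ id
    Tid+Fid = trans≈ (TL.Tmap-resp (trans≈ (+₁-cong₂ refl≈ Sg.F-id) id+id)) TL.Tmap-id

    endo-id : ∀ {X} {h : TΣ X ⇒ TΣ X} → out ∘ h ≈ T.Tmap (id +₁ F₁ h) ∘ out → h ≈ id
    endo-id p = trans≈ (unfold-unique p) (sym≈ (unfold-unique (trans≈ identityʳ (sym≈ (elimˡ Tid+Fid)))))

    out⁻¹∘out : ∀ {X} → out⁻¹ ∘ out ≈ id {TΣ X}
    out⁻¹∘out = endo-id (trans≈ (pullˡ unfold-eq) (Tid+F∘ ⟩∘⟨refl))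

    out∘out⁻¹ : ∀ {X} → out ∘ out⁻¹ ≈ id {T₀ (X + F₀ (TΣ X))}
    out∘out⁻¹ = trans≈ unfold-eq (trans≈ Tid+F∘
                  (trans≈ (TL.Tmap-resp (+₁-cong₂ refl≈ (Sg.F-resp-≈ out⁻¹∘out))) Tid+Fid))

    out-mono : ∀ {A X} {a b : A ⇒ TΣ X} → out ∘ a ≈ out ∘ b → a ≈ b
    out-mono {a = a} {b} p = begin
      a                 ≈⟨ sym≈ (elimˡ out⁻¹∘out) ⟩
      (out⁻¹ ∘ out) ∘ a ≈⟨ pullʳ p ⟩
      out⁻¹ ∘ out ∘ b   ≈⟨ pullˡ out⁻¹∘out ⟩
      id ∘ b            ≈⟨ identityˡ ⟩
      b                 ∎

    node : ∀ {X} → F₀ (TΣ X) ⇒ TΣ X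
    node = out⁻¹ ∘ T.η ∘ inr

    out-ext : ∀ {X} → out ∘ ext FC M {X} ≈ T.Tmap inl
    out-ext = trans≈ (pullˡ out∘out⁻¹) identityˡ

    out-node : ∀ {X} → out ∘ node {X} ≈ T.η ∘ inr
    out-node = trans≈ (pullˡ out∘out⁻¹) identityˡ

    ι-node : ∀ {X} → ι FC M {X} ≈ node ∘ F₁ M.η
    ι-node = trans≈ sym-assoc (trans≈ sym-assoc (assoc ⟩∘⟨refl))

    out-ι : ∀ {X} → out ∘ ι FC M {X} ≈ T.η ∘ inr ∘ F₁ M.η
    out-ι = trans≈ (refl⟩∘⟨ ι-node) (trans≈ (pullˡ out-node) assoc)

    out-bind-out⁻¹ : ∀ {X Y} {k : X ⇒ TΣ Y} → out ∘ k M.* ∘ out⁻¹ ≈ [ out ∘ k , T.η ∘ inr ∘ F₁ (k M.*) ] T.*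
    out-bind-out⁻¹ = trans≈ (pullˡ bind-eq) (trans≈ assoc (elimʳ out∘out⁻¹))

    out-bind-pure : ∀ {A X Y} {k : X ⇒ TΣ Y} {t : A ⇒ TΣ X} {c : A ⇒ T₀ X} →
                    out ∘ t ≈ T.Tmap inl ∘ c → out ∘ k M.* ∘ t ≈ (out ∘ k) T.* ∘ c
    out-bind-pure {k = k} {t} {c} p = begin
      out ∘ k M.* ∘ t                                      ≈⟨ refl⟩∘⟨ refl⟩∘⟨ t≈ ⟩
      out ∘ k M.* ∘ out⁻¹ ∘ T.Tmap inl ∘ c                 ≈⟨ trans≈ (refl⟩∘⟨ sym-assoc) sym-assoc ⟩
      (out ∘ k M.* ∘ out⁻¹) ∘ T.Tmap inl ∘ c               ≈⟨ out-bind-out⁻¹ ⟩∘⟨refl ⟩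
      [ out ∘ k , T.η ∘ inr ∘ F₁ (k M.*) ] T.* ∘ T.Tmap inl ∘ c ≈⟨ TL.*∘Tmap∘ ⟩
      ([ out ∘ k , T.η ∘ inr ∘ F₁ (k M.*) ] ∘ inl) T.* ∘ c ≈⟨ T.*-resp-≈ inject₁ ⟩∘⟨refl ⟩
      (out ∘ k) T.* ∘ c                                    ∎
      where
        t≈ : t ≈ out⁻¹ ∘ T.Tmap inl ∘ c
        t≈ = trans≈ (sym≈ (elimˡ out⁻¹∘out)) (pullʳ p)

    out-bind-node : ∀ {X Y} {k : X ⇒ TΣ Y} → out ∘ k M.* ∘ node ≈ T.η ∘ inr ∘ F₁ (k M.*)
    out-bind-node = trans≈ (refl⟩∘⟨ sym-assoc) (trans≈ (pullˡ out-bind-out⁻¹) (trans≈ TL.*η' inject₂))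

    -- the trees of height one: a leaf, or a node with arbitrary children
    step : ∀ {A B} → A + F₀ (TΣ (A + B)) ⇒ TΣ (A + B)
    step = [ M.η ∘ inl , node ]

    out-bind-step : ∀ {A B} {k : A + B ⇒ TΣ A} → k ∘ inl ≈ M.η →
                    out ∘ k M.* ∘ step ≈ T.η ∘ (id +₁ F₁ (k M.*))
    out-bind-step {k = k} k-inl = begin
      out ∘ k M.* ∘ step                                      ≈⟨ trans≈ (refl⟩∘⟨ ∘[]) ∘[] ⟩
      [ out ∘ k M.* ∘ M.η ∘ inl , out ∘ k M.* ∘ node ]        ≈⟨ []-cong₂ leaf out-bind-node ⟩
      [ T.η ∘ inl , T.η ∘ inr ∘ F₁ (k M.*) ]                  ≈⟨ sym≈ (trans≈ ∘[] ([]-cong₂ (refl⟩∘⟨ identityʳ) refl≈)) ⟩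
      T.η ∘ (id +₁ F₁ (k M.*))                                ∎
      where
        leaf : out ∘ k M.* ∘ M.η ∘ inl ≈ T.η ∘ inl
        leaf = trans≈ (refl⟩∘⟨ ML.*η') (trans≈ (refl⟩∘⟨ k-inl) unit-eq)

    -- The first T-layer of a loop body g : X → TΣ (Y + X), in which reaching
    -- X (a leaf of g) is a loop exit and nodes are kept as outputs.
    first-layer : ∀ {X Y} → X ⇒ TΣ (Y + X) → X ⇒ T₀ ((Y + F₀ (TΣ (Y + X))) + X)
    first-layer g = T.Tmap loop-middle ∘ out ∘ g

    decomposition : ∀ {X Y} {g : X ⇒ TΣ (Y + X)} →
                    g ≈ [ step , M.η ∘ inr ] M.* ∘ ext FC M ∘ first-layer g
    decomposition {g = g} = out-mono (sym≈ (begin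
      out ∘ [ step , M.η ∘ inr ] M.* ∘ ext FC M ∘ first-layer g     ≈⟨ out-bind-pure (pullˡ out-ext) ⟩
      (out ∘ [ step , M.η ∘ inr ]) T.* ∘ T.Tmap loop-middle ∘ out ∘ g ≈⟨ TL.*∘Tmap∘ ⟩
      ((out ∘ [ step , M.η ∘ inr ]) ∘ loop-middle) T.* ∘ out ∘ g     ≈⟨ T.*-resp-≈ reassemble ⟩∘⟨refl ⟩
      T.η T.* ∘ out ∘ g                                              ≈⟨ elimˡ T.η* ⟩
      out ∘ g                                                        ∎))
      where
        reassemble : (out ∘ [ step , M.η ∘ inr ]) ∘ loop-middle ≈ T.η
        reassemble = +-ext3
          (trans≈ (pullʳ (trans≈ (pullˡ inject₁) inject₁)) (trans≈ (pullʳ (trans≈ (pullˡ inject₁) inject₁))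
            (trans≈ (pullˡ unit-eq) assoc)))
          (trans≈ (pullʳ (trans≈ (pullˡ inject₁) inject₂)) (trans≈ (pullʳ inject₂)
            (trans≈ (pullˡ unit-eq) assoc)))
          (trans≈ (pullʳ inject₂) (trans≈ (pullʳ (trans≈ (pullˡ inject₁) inject₂)) out-node))

    out-dagger : ∀ {X Y} {g : X ⇒ TΣ (Y + X)} →
                 out ∘ g M.† ≈ T.Tmap (id +₁ F₁ ([ M.η , g M.† ] M.*)) ∘ first-layer g T.†
    out-dagger {g = g} = begin
      out ∘ g M.†                                                     ≈⟨ refl⟩∘⟨ staged ⟩
      out ∘ ([ M.η , g M.† ] M.* ∘ step) M.* ∘ (ext FC M ∘ first-layer g) M.†
                                                                      ≈⟨ out-bind-pure (dagger-eq (pullˡ out-ext)) ⟩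
      (out ∘ [ M.η , g M.† ] M.* ∘ step) T.* ∘ first-layer g T.†      ≈⟨ T.*-resp-≈ (out-bind-step inject₁) ⟩∘⟨refl ⟩
      T.Tmap (id +₁ F₁ ([ M.η , g M.† ] M.*)) ∘ first-layer g T.†     ∎
      where
        staged : g M.† ≈ ([ M.η , g M.† ] M.* ∘ step) M.* ∘ (ext FC M ∘ first-layer g) M.†
        staged = trans≈ (M.†-resp-≈ decomposition) (trans≈ ML.†-staged
                   (M.*-resp-≈ (M.*-resp-≈ ([]-cong₂ refl≈ (sym≈ (M.†-resp-≈ decomposition))) ⟩∘⟨refl) ⟩∘⟨refl))

    -- one layer of a tree re-expressed inside TΣ: leaves stay leaves, and
    -- the children of a node become leaves in the right summand
    reconstruct : ∀ {X} → TΣ X ⇒ TΣ (X + TΣ X)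
    reconstruct = [ M.η ∘ inl , ι FC M ∘ F₁ inr ] M.* ∘ ext FC M ∘ out

    reconstruct-† : ∀ {X} → reconstruct M.† ≈ id {TΣ X}
    reconstruct-† = endo-id (begin
      out ∘ reconstruct M.†                                    ≈⟨ refl⟩∘⟨ sym≈ M.unfold-law ⟩
      out ∘ L M.* ∘ K M.* ∘ ext FC M ∘ out                     ≈⟨ refl⟩∘⟨ ML.*∘*∘ ⟩
      out ∘ (L M.* ∘ K) M.* ∘ ext FC M ∘ out                   ≈⟨ out-bind-pure (pullˡ out-ext) ⟩
      (out ∘ L M.* ∘ K) T.* ∘ out                              ≈⟨ T.*-resp-≈ one-layer ⟩∘⟨refl ⟩
      T.Tmap (id +₁ F₁ (reconstruct M.†)) ∘ out                ∎)
      where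
        K = [ M.η ∘ inl , ι FC M ∘ F₁ inr ]
        L = [ M.η , reconstruct M.† ]
        K-step : K ≈ step ∘ (id +₁ F₁ (M.η ∘ inr))
        K-step = sym≈ (trans≈ []∘+₁ ([]-cong₂ identityʳ
                   (trans≈ (refl⟩∘⟨ Sg.F-∘) (trans≈ sym-assoc (sym≈ ι-node ⟩∘⟨refl)))))
        one-layer : out ∘ L M.* ∘ K ≈ T.η ∘ (id +₁ F₁ (reconstruct M.†))
        one-layer = begin
          out ∘ L M.* ∘ K                                           ≈⟨ refl⟩∘⟨ refl⟩∘⟨ K-step ⟩
          out ∘ L M.* ∘ step ∘ (id +₁ F₁ (M.η ∘ inr))               ≈⟨ trans≈ (refl⟩∘⟨ sym-assoc) sym-assoc ⟩
          (out ∘ L M.* ∘ step) ∘ (id +₁ F₁ (M.η ∘ inr))             ≈⟨ trans≈ (out-bind-step inject₁ ⟩∘⟨refl) assoc ⟩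
          T.η ∘ (id +₁ F₁ (L M.*)) ∘ (id +₁ F₁ (M.η ∘ inr))         ≈⟨ refl⟩∘⟨ +₁∘+₁ ⟩
          T.η ∘ ((id ∘ id) +₁ (F₁ (L M.*) ∘ F₁ (M.η ∘ inr)))        ≈⟨ refl⟩∘⟨ +₁-cong₂ identityˡ
                                                                         (trans≈ (sym≈ Sg.F-∘) (Sg.F-resp-≈ (trans≈ ML.*η' inject₂))) ⟩
          T.η ∘ (id +₁ F₁ (reconstruct M.†))                         ∎

    module Mediating {S₀ : Obj → Obj} (S : CompleteElgotMonadOn S₀)
                     (υ : StrongNatTrans Sig S) (σ : ElgotMorphism T S) where
      module S = CompleteElgotMonadOn S
      module SL = ElgotLaws S
      module υ = StrongNatTrans υ
      module σ = ElgotMorphism σ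

      -- one layer of a tree interpreted in S: leaves exit, nodes are
      -- performed by υ and continue in the child
      layer : ∀ {A B} → A + F₀ B ⇒ S₀ (A + B)
      layer = [ S.η ∘ inl , S.Tmap inr ∘ υ.α ]

      perform-natural : ∀ {A B B'} {h : B ⇒ B'} →
                        (S.Tmap (inr {A}) ∘ υ.α) ∘ F₁ h ≈ S.Tmap (inr ∘ h) ∘ υ.α
      perform-natural = trans≈ (pullʳ υ.natural) SL.Tmap∘Tmap∘

      layer-natural : ∀ {A B B'} {h : B ⇒ B'} → layer ∘ (id {A} +₁ F₁ h) ≈ S.Tmap (id +₁ h) ∘ layer
      layer-natural = trans≈ []∘+₁ (trans≈ ([]-cong₂ identityʳ perform-natural)
                        (sym≈ (trans≈ ∘[] ([]-cong₂ SL.Tmap+η-inl SL.Tmap+∘Tmap-inr))))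

      layer-strong : ∀ {X A B} → layer ∘ (id +₁ Sg.ρ) ∘ dist ≈ S.Tmap dist ∘ S.τ ∘ (id {X} ⁂ layer {A} {B})
      layer-strong = dist-ext
        (begin
           (layer ∘ (id +₁ Sg.ρ) ∘ dist) ∘ (id ⁂ inl)       ≈⟨ pullʳ (pullʳ dist-inl) ⟩
           layer ∘ (id +₁ Sg.ρ) ∘ inl                       ≈⟨ refl⟩∘⟨ trans≈ inject₁ identityʳ ⟩
           layer ∘ inl                                      ≈⟨ inject₁ ⟩
           S.η ∘ inl                                        ≈⟨ sym≈ (refl⟩∘⟨ dist-inl) ⟩
           S.η ∘ dist ∘ (id ⁂ inl)                          ≈⟨ sym≈ SL.Tmap-η' ⟩
           S.Tmap dist ∘ S.η ∘ (id ⁂ inl)                   ≈⟨ sym≈ (refl⟩∘⟨ pullˡ S.τ-η) ⟩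
           S.Tmap dist ∘ S.τ ∘ (id ⁂ S.η) ∘ (id ⁂ inl)      ≈⟨ sym≈ (refl⟩∘⟨ refl⟩∘⟨ trans≈ (⁂-cong₂ refl≈ inject₁) id⁂∘) ⟩
           S.Tmap dist ∘ S.τ ∘ (id ⁂ (layer ∘ inl))         ≈⟨ trans≈ (refl⟩∘⟨ refl⟩∘⟨ id⁂∘) (trans≈ (refl⟩∘⟨ sym-assoc) sym-assoc) ⟩
           (S.Tmap dist ∘ S.τ ∘ (id ⁂ layer)) ∘ (id ⁂ inl)  ∎)
        (begin
           (layer ∘ (id +₁ Sg.ρ) ∘ dist) ∘ (id ⁂ inr)       ≈⟨ pullʳ (pullʳ dist-inr) ⟩
           layer ∘ (id +₁ Sg.ρ) ∘ inr                       ≈⟨ trans≈ (refl⟩∘⟨ inject₂) (pullˡ inject₂) ⟩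
           (S.Tmap inr ∘ υ.α) ∘ Sg.ρ                        ≈⟨ assoc ⟩
           S.Tmap inr ∘ υ.α ∘ Sg.ρ                          ≈⟨ SL.Tmap-resp (sym≈ dist-inr) ⟩∘⟨ sym≈ υ.strong ⟩
           S.Tmap (dist ∘ (id ⁂ inr)) ∘ S.τ ∘ (id ⁂ υ.α)    ≈⟨ sym≈ SL.Tmap∘Tmap∘ ⟩
           S.Tmap dist ∘ S.Tmap (id ⁂ inr) ∘ S.τ ∘ (id ⁂ υ.α) ≈⟨ sym≈ (refl⟩∘⟨ trans≈ (pullˡ S.τ-natural) assoc) ⟩
           S.Tmap dist ∘ S.τ ∘ (id ⁂ S.Tmap inr) ∘ (id ⁂ υ.α) ≈⟨ sym≈ (refl⟩∘⟨ refl⟩∘⟨ trans≈ (⁂-cong₂ refl≈ inject₂) id⁂∘) ⟩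
           S.Tmap dist ∘ S.τ ∘ (id ⁂ (layer ∘ inr))         ≈⟨ trans≈ (refl⟩∘⟨ refl⟩∘⟨ id⁂∘) (trans≈ (refl⟩∘⟨ sym-assoc) sym-assoc) ⟩
           (S.Tmap dist ∘ S.τ ∘ (id ⁂ layer)) ∘ (id ⁂ inr)  ∎)

      σout : ∀ {X} → TΣ X ⇒ S₀ (X + F₀ (TΣ X))
      σout = σ.ξ ∘ out

      ζ₀ : ∀ {X} → TΣ X ⇒ S₀ (X + TΣ X)
      ζ₀ = ζ FC M υ σ

      ξ₀ : ∀ {X} → TΣ X ⇒ S₀ X
      ξ₀ = ζ₀ S.†

      interpret-pure : ∀ {A B C} {j : A ⇒ B + F₀ C} → layer S.* ∘ σ.ξ ∘ T.η ∘ j ≈ layer ∘ j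
      interpret-pure = trans≈ (refl⟩∘⟨ pullˡ σ.unit) SL.*η'

      ζ-pure : ∀ {A X} {t : A ⇒ TΣ X} {j : A ⇒ X + F₀ (TΣ X)} → out ∘ t ≈ T.η ∘ j → ζ₀ ∘ t ≈ layer ∘ j
      ζ-pure p = trans≈ (trans≈ assoc (refl⟩∘⟨ assoc)) (trans≈ (refl⟩∘⟨ refl⟩∘⟨ p) interpret-pure)

      ζ-η : ∀ {X} → ζ₀ ∘ M.η ≈ S.η ∘ inl {X}
      ζ-η = trans≈ (ζ-pure unit-eq) inject₁

      ξ-unfold : ∀ {A X} {t : A ⇒ TΣ X} {c : A ⇒ S₀ (X + TΣ X)} → ζ₀ ∘ t ≈ c → ξ₀ ∘ t ≈ [ S.η , ξ₀ ] S.* ∘ c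
      ξ-unfold p = trans≈ (sym≈ S.unfold-law ⟩∘⟨refl) (pullʳ p)

      ξ-ext : ∀ {X} → ξ₀ ∘ ext FC M ≈ σ.ξ {X}
      ξ-ext = trans≈ (ξ-unfold ζ-ext) (trans≈ (pullˡ SL.[]*∘Tmap-inl) identityˡ)
        where
          ζ-ext : ζ₀ ∘ ext FC M ≈ S.Tmap inl ∘ σ.ξ
          ζ-ext = begin
            (layer S.* ∘ σ.ξ ∘ out) ∘ ext FC M  ≈⟨ trans≈ assoc (refl⟩∘⟨ assoc) ⟩
            layer S.* ∘ σ.ξ ∘ out ∘ ext FC M    ≈⟨ refl⟩∘⟨ refl⟩∘⟨ out-ext ⟩
            layer S.* ∘ σ.ξ ∘ T.Tmap inl        ≈⟨ refl⟩∘⟨ σ.natural ⟩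
            layer S.* ∘ S.Tmap inl ∘ σ.ξ        ≈⟨ SL.*∘Tmap∘ ⟩
            (layer ∘ inl) S.* ∘ σ.ξ             ≈⟨ S.*-resp-≈ inject₁ ⟩∘⟨refl ⟩
            S.Tmap inl ∘ σ.ξ                    ∎

      ξ-η : ∀ {X} → ξ₀ ∘ M.η ≈ S.η {X}
      ξ-η = trans≈ (ξ-unfold ζ-η) (trans≈ SL.*η' inject₁)

      ξ-ι : ∀ {X} → ξ₀ ∘ ι FC M ≈ υ.α {X}
      ξ-ι = begin
        ξ₀ ∘ ι FC M                                   ≈⟨ ξ-unfold (ζ-pure out-ι) ⟩
        [ S.η , ξ₀ ] S.* ∘ layer ∘ inr ∘ F₁ M.η        ≈⟨ refl⟩∘⟨ pullˡ inject₂ ⟩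
        [ S.η , ξ₀ ] S.* ∘ (S.Tmap inr ∘ υ.α) ∘ F₁ M.η ≈⟨ refl⟩∘⟨ trans≈ assoc (refl⟩∘⟨ υ.natural) ⟩
        [ S.η , ξ₀ ] S.* ∘ S.Tmap inr ∘ S.Tmap M.η ∘ υ.α ≈⟨ SL.*∘Tmap∘ ⟩
        ([ S.η , ξ₀ ] ∘ inr) S.* ∘ S.Tmap M.η ∘ υ.α    ≈⟨ S.*-resp-≈ inject₂ ⟩∘⟨refl ⟩
        ξ₀ S.* ∘ S.Tmap M.η ∘ υ.α                     ≈⟨ SL.*∘Tmap∘ ⟩
        (ξ₀ ∘ M.η) S.* ∘ υ.α                          ≈⟨ S.*-resp-≈ ξ-η ⟩∘⟨refl ⟩
        S.η S.* ∘ υ.α                                 ≈⟨ elimˡ S.η* ⟩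
        υ.α                                           ∎

      ζ-bind : ∀ {X Y} {f : X ⇒ TΣ Y} → ζ₀ ∘ f M.* ≈ [ ζ₀ ∘ f , S.Tmap (inr ∘ f M.*) ∘ υ.α ] S.* ∘ σout
      ζ-bind {f = f} = begin
        (layer S.* ∘ σ.ξ ∘ out) ∘ f M.*                                       ≈⟨ trans≈ assoc (refl⟩∘⟨ assoc) ⟩
        layer S.* ∘ σ.ξ ∘ out ∘ f M.*                                         ≈⟨ refl⟩∘⟨ refl⟩∘⟨ bind-eq ⟩
        layer S.* ∘ σ.ξ ∘ [ out ∘ f , T.η ∘ inr ∘ F₁ (f M.*) ] T.* ∘ out      ≈⟨ refl⟩∘⟨ trans≈ (pullˡ σ.bind) assoc ⟩
        layer S.* ∘ (σ.ξ ∘ [ out ∘ f , T.η ∘ inr ∘ F₁ (f M.*) ]) S.* ∘ σ.ξ ∘ out ≈⟨ SL.*∘*∘ ⟩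
        (layer S.* ∘ σ.ξ ∘ [ out ∘ f , T.η ∘ inr ∘ F₁ (f M.*) ]) S.* ∘ σout   ≈⟨ S.*-resp-≈ components ⟩∘⟨refl ⟩
        [ ζ₀ ∘ f , S.Tmap (inr ∘ f M.*) ∘ υ.α ] S.* ∘ σout                    ∎
        where
          components : layer S.* ∘ σ.ξ ∘ [ out ∘ f , T.η ∘ inr ∘ F₁ (f M.*) ]
                       ≈ [ ζ₀ ∘ f , S.Tmap (inr ∘ f M.*) ∘ υ.α ]
          components = trans≈ (refl⟩∘⟨ ∘[]) (trans≈ ∘[] ([]-cong₂
                (trans≈ (refl⟩∘⟨ sym-assoc) sym-assoc)
                (trans≈ interpret-pure (trans≈ (pullˡ inject₂) perform-natural))))

      -- ξ₀ preserves Kleisli extension.  ξ₀ ∘ f* iterates ζ₀ on the union of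
      -- the states TΣ X and TΣ Y: first the X-tree, whose leaves continue
      -- with the trees f, then the Y-trees reached.  The Bekič-style law
      -- separates the two phases.
      ξ-bind : ∀ {X Y} {f : X ⇒ TΣ Y} → ξ₀ ∘ f M.* ≈ (ξ₀ ∘ f) S.* ∘ ξ₀
      ξ-bind {X} {Y} {f} = begin
        ξ₀ ∘ f M.*                                ≈⟨ sym≈ (pullʳ inject₁) ⟩
        (ξ₀ ∘ [ f M.* , id ]) ∘ inl               ≈⟨ S.uniformity ζ-on-union ⟩∘⟨refl ⟩
        joint S.† ∘ inl                           ≈⟨ SL.†-sequential ⟩
        [ S.η , ξ₀ ] S.* ∘ ζ-then-f S.†           ≈⟨ refl⟩∘⟨ sym≈ S.naturality ⟩
        [ S.η , ξ₀ ] S.* ∘ (ζ₀ ∘ f) S.* ∘ ξ₀      ≈⟨ SL.*∘*∘ ⟩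
        ([ S.η , ξ₀ ] S.* ∘ ζ₀ ∘ f) S.* ∘ ξ₀      ≈⟨ S.*-resp-≈ (pullˡ S.unfold-law) ⟩∘⟨refl ⟩
        (ξ₀ ∘ f) S.* ∘ ξ₀                         ∎
        where
          -- a layer of the X-tree, leaves continuing with a layer of f
          ζ-then-f : TΣ X ⇒ S₀ ((Y + TΣ Y) + TΣ X)
          ζ-then-f = [ S.Tmap inl ∘ ζ₀ ∘ f , S.η ∘ inr ] S.* ∘ ζ₀
          joint : TΣ X + TΣ Y ⇒ S₀ (Y + (TΣ X + TΣ Y))
          joint = [ S.Tmap [ id +₁ inr , inr ∘ inl ] ∘ ζ-then-f , S.Tmap (id +₁ inr) ∘ ζ₀ ]
          collapse : Y + (TΣ X + TΣ Y) ⇒ Y + TΣ Y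
          collapse = id +₁ [ f M.* , id ]
          collapse-inr : collapse ∘ (id +₁ inr {TΣ X} {TΣ Y}) ≈ id
          collapse-inr = trans≈ +₁∘+₁ (trans≈ (+₁-cong₂ identityˡ inject₂) id+id)
          collapse-left : collapse ∘ [ id +₁ inr , inr ∘ inl ] ≈ [ id , inr ∘ f M.* ]
          collapse-left = trans≈ ∘[] ([]-cong₂ collapse-inr (trans≈ (pullˡ inject₂) (trans≈ assoc (refl⟩∘⟨ inject₁))))
          continue : X + TΣ X ⇒ S₀ (Y + TΣ Y)
          continue = S.Tmap [ id , inr ∘ f M.* ] ∘ [ S.Tmap inl ∘ ζ₀ ∘ f , S.η ∘ inr ]
          continue-layer : continue S.* ∘ layer ≈ [ ζ₀ ∘ f , S.Tmap (inr ∘ f M.*) ∘ υ.α ]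
          continue-layer = trans≈ ∘[] ([]-cong₂
                 (trans≈ SL.*η' (trans≈ (pullʳ inject₁) (trans≈ SL.Tmap∘Tmap∘
                   (elimˡ (trans≈ (SL.Tmap-resp inject₁) SL.Tmap-id)))))
                 (trans≈ SL.*∘Tmap∘ (S.*-resp-≈ (trans≈ (pullʳ inject₂) (trans≈ SL.Tmap-η' (refl⟩∘⟨ inject₂))) ⟩∘⟨refl)))
          ζ-on-union : ζ₀ ∘ [ f M.* , id ] ≈ S.Tmap collapse ∘ joint
          ζ-on-union = +-ext
            (begin
               (ζ₀ ∘ [ f M.* , id ]) ∘ inl                                 ≈⟨ pullʳ inject₁ ⟩
               ζ₀ ∘ f M.*                                                  ≈⟨ ζ-bind ⟩
               [ ζ₀ ∘ f , S.Tmap (inr ∘ f M.*) ∘ υ.α ] S.* ∘ σout          ≈⟨ sym≈ (S.*-resp-≈ continue-layer) ⟩∘⟨refl ⟩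
               (continue S.* ∘ layer) S.* ∘ σout                           ≈⟨ sym≈ SL.*∘*∘ ⟩
               continue S.* ∘ ζ₀                                           ≈⟨ sym≈ SL.Tmap∘*∘ ⟩
               S.Tmap [ id , inr ∘ f M.* ] ∘ ζ-then-f                      ≈⟨ sym≈ (SL.Tmap-resp collapse-left) ⟩∘⟨refl ⟩
               S.Tmap (collapse ∘ [ id +₁ inr , inr ∘ inl ]) ∘ ζ-then-f    ≈⟨ sym≈ SL.Tmap∘Tmap∘ ⟩
               S.Tmap collapse ∘ S.Tmap [ id +₁ inr , inr ∘ inl ] ∘ ζ-then-f ≈⟨ sym≈ (pullʳ inject₁) ⟩
               (S.Tmap collapse ∘ joint) ∘ inl                             ∎)
            (begin
               (ζ₀ ∘ [ f M.* , id ]) ∘ inr                                 ≈⟨ trans≈ (pullʳ inject₂) identityʳ ⟩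
               ζ₀                                                          ≈⟨ sym≈ (elimˡ (trans≈ (SL.Tmap-resp collapse-inr) SL.Tmap-id)) ⟩
               S.Tmap (collapse ∘ (id +₁ inr)) ∘ ζ₀                        ≈⟨ sym≈ SL.Tmap∘Tmap∘ ⟩
               S.Tmap collapse ∘ S.Tmap (id +₁ inr) ∘ ζ₀                   ≈⟨ sym≈ (pullʳ inject₂) ⟩
               (S.Tmap collapse ∘ joint) ∘ inr                             ∎)

      ξ-natural : ∀ {X Y} {f : X ⇒ Y} → ξ₀ ∘ M.Tmap f ≈ S.Tmap f ∘ ξ₀
      ξ-natural = trans≈ ξ-bind (S.*-resp-≈ (pullˡ ξ-η) ⟩∘⟨refl)

      -- ζ₀ commutes with the strengths, up to the strength of TΣ on the
      -- children; the strength law of S's iteration then gives that of ξ₀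
      ζ-strength : ∀ {X Y} → ζ₀ ∘ M.τ {X} {Y} ≈ S.Tmap (id +₁ M.τ) ∘ S.Tmap dist ∘ S.τ ∘ (id ⁂ ζ₀)
      ζ-strength = begin
        (layer S.* ∘ σ.ξ ∘ out) ∘ M.τ                                ≈⟨ trans≈ assoc (refl⟩∘⟨ assoc) ⟩
        layer S.* ∘ σ.ξ ∘ out ∘ M.τ                                  ≈⟨ refl⟩∘⟨ refl⟩∘⟨ strength-eq ⟩
        layer S.* ∘ σ.ξ ∘ T.Tmap a ∘ T.Tmap b ∘ T.τ ∘ (id ⁂ out)     ≈⟨ refl⟩∘⟨ translate ⟩
        layer S.* ∘ S.Tmap a ∘ S.Tmap b ∘ S.τ ∘ (id ⁂ σout)          ≈⟨ trans≈ SL.*∘Tmap∘ SL.*∘Tmap∘ ⟩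
        ((layer ∘ a) ∘ b) S.* ∘ S.τ ∘ (id ⁂ σout)                    ≈⟨ S.*-resp-≈ layer-ab ⟩∘⟨refl ⟩
        (S.Tmap (id +₁ M.τ) ∘ S.Tmap dist ∘ S.τ ∘ (id ⁂ layer)) S.* ∘ S.τ ∘ (id ⁂ σout)
                                                                     ≈⟨ sym≈ (trans≈ (refl⟩∘⟨ SL.Tmap∘*∘) SL.Tmap∘*∘) ⟩
        S.Tmap (id +₁ M.τ) ∘ S.Tmap dist ∘ (S.τ ∘ (id ⁂ layer)) S.* ∘ S.τ ∘ (id ⁂ σout)
                                                                     ≈⟨ refl⟩∘⟨ refl⟩∘⟨ sym≈ (trans≈ (pullˡ S.τ-*) assoc) ⟩
        S.Tmap (id +₁ M.τ) ∘ S.Tmap dist ∘ S.τ ∘ (id ⁂ layer S.*) ∘ (id ⁂ σout)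
                                                                     ≈⟨ refl⟩∘⟨ refl⟩∘⟨ refl⟩∘⟨ sym≈ id⁂∘ ⟩
        S.Tmap (id +₁ M.τ) ∘ S.Tmap dist ∘ S.τ ∘ (id ⁂ ζ₀)           ∎
        where
          a = id +₁ F₁ M.τ
          b = (id +₁ Sg.ρ) ∘ dist
          translate : σ.ξ ∘ T.Tmap a ∘ T.Tmap b ∘ T.τ ∘ (id ⁂ out) ≈ S.Tmap a ∘ S.Tmap b ∘ S.τ ∘ (id ⁂ σout)
          translate = trans≈ (pullˡ σ.natural) (trans≈ assoc (refl⟩∘⟨ trans≈ (pullˡ σ.natural) (trans≈ assoc
                        (refl⟩∘⟨ trans≈ (pullˡ σ.strength) (trans≈ assoc (refl⟩∘⟨ sym≈ id⁂∘))))))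
          layer-ab : (layer ∘ a) ∘ b ≈ S.Tmap (id +₁ M.τ) ∘ S.Tmap dist ∘ S.τ ∘ (id ⁂ layer)
          layer-ab = trans≈ (layer-natural ⟩∘⟨refl) (trans≈ assoc (refl⟩∘⟨ layer-strong))

      ξ-strength : ∀ {X Y} → ξ₀ ∘ M.τ {X} {Y} ≈ S.τ ∘ (id ⁂ ξ₀)
      ξ-strength = trans≈ (S.uniformity ζ-strength) (sym≈ S.strength)

      -- For a loop body g, g† = resume* ∘ g with
      -- resume = [η , g†].  ξ₀ ∘ resume* iterates a body in which reaching X
      -- runs the S-translation of g's first-layer loop; resolving that inner
      -- loop turns it into the iteration of ζ₀ with jumps to g, i.e. (ξ₀ ∘ g)†.
      module _ {X Y : Obj} (g : X ⇒ TΣ (Y + X)) where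
        resume : Y + X ⇒ TΣ Y
        resume = [ M.η , g M.† ]

        inner : X ⇒ S₀ (Y + TΣ (Y + X))
        inner = layer S.* ∘ (S.Tmap loop-middle ∘ σout ∘ g) S.†

        resolved jumping : TΣ (Y + X) ⇒ S₀ (Y + TΣ (Y + X))
        resolved = [ [ S.η ∘ inl , inner ] , S.Tmap inr ∘ υ.α ] S.* ∘ σout
        jumping = [ [ S.η ∘ inl , S.η ∘ inr ∘ g ] , S.Tmap inr ∘ υ.α ] S.* ∘ σout

        -- ζ₀ after g† is the S-translation of out-dagger
        ζ-dagger : ζ₀ ∘ g M.† ≈ S.Tmap (id +₁ resume M.*) ∘ inner
        ζ-dagger = begin
          (layer S.* ∘ σ.ξ ∘ out) ∘ g M.†                                     ≈⟨ trans≈ assoc (refl⟩∘⟨ assoc) ⟩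
          layer S.* ∘ σ.ξ ∘ out ∘ g M.†                                       ≈⟨ refl⟩∘⟨ refl⟩∘⟨ out-dagger ⟩
          layer S.* ∘ σ.ξ ∘ T.Tmap (id +₁ F₁ (resume M.*)) ∘ first-layer g T.†  ≈⟨ refl⟩∘⟨ trans≈ (pullˡ σ.natural) assoc ⟩
          layer S.* ∘ S.Tmap (id +₁ F₁ (resume M.*)) ∘ σ.ξ ∘ first-layer g T.†  ≈⟨ refl⟩∘⟨ refl⟩∘⟨ sym≈ σ.dagger ⟩
          layer S.* ∘ S.Tmap (id +₁ F₁ (resume M.*)) ∘ (σ.ξ ∘ first-layer g) S.† ≈⟨ SL.*∘Tmap∘ ⟩
          (layer ∘ (id +₁ F₁ (resume M.*))) S.* ∘ (σ.ξ ∘ first-layer g) S.†    ≈⟨ S.*-resp-≈ layer-natural ⟩∘⟨ S.†-resp-≈ translate ⟩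
          (S.Tmap (id +₁ resume M.*) ∘ layer) S.* ∘ (S.Tmap loop-middle ∘ σout ∘ g) S.† ≈⟨ sym≈ SL.Tmap∘*∘ ⟩
          S.Tmap (id +₁ resume M.*) ∘ inner                                   ∎
          where
            translate : σ.ξ ∘ first-layer g ≈ S.Tmap loop-middle ∘ σout ∘ g
            translate = trans≈ (pullˡ σ.natural) (trans≈ assoc (refl⟩∘⟨ sym-assoc))

        ξ-resume : ξ₀ ∘ resume M.* ≈ resolved S.†
        ξ-resume = S.uniformity (begin
          ζ₀ ∘ resume M.*                                                      ≈⟨ ζ-bind ⟩
          [ ζ₀ ∘ resume , S.Tmap (inr ∘ resume M.*) ∘ υ.α ] S.* ∘ σout         ≈⟨ S.*-resp-≈ components ⟩∘⟨refl ⟩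
          (S.Tmap (id +₁ resume M.*) ∘ [ [ S.η ∘ inl , inner ] , S.Tmap inr ∘ υ.α ]) S.* ∘ σout ≈⟨ sym≈ SL.Tmap∘*∘ ⟩
          S.Tmap (id +₁ resume M.*) ∘ resolved                                 ∎)
          where
            components : [ ζ₀ ∘ resume , S.Tmap (inr ∘ resume M.*) ∘ υ.α ]
                         ≈ S.Tmap (id +₁ resume M.*) ∘ [ [ S.η ∘ inl , inner ] , S.Tmap inr ∘ υ.α ]
            components = sym≈ (trans≈ ∘[] ([]-cong₂
                (trans≈ ∘[] (trans≈ ([]-cong₂ SL.Tmap+η-inl (sym≈ ζ-dagger)) (sym≈ (trans≈ ∘[] ([]-cong₂ ζ-η refl≈)))))
                SL.Tmap+∘Tmap-inr))

        jumping-ζ : jumping ≈ S.Tmap [ id , inr ] ∘ S.Tmap ((id +₁ g) +₁ id) ∘ ζ₀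
        jumping-ζ = sym≈ (begin
          S.Tmap [ id , inr ] ∘ S.Tmap ((id +₁ g) +₁ id) ∘ layer S.* ∘ σout ≈⟨ SL.Tmap∘Tmap∘ ⟩
          S.Tmap feed ∘ layer S.* ∘ σout                                    ≈⟨ SL.Tmap∘*∘ ⟩
          (S.Tmap feed ∘ layer) S.* ∘ σout                                  ≈⟨ S.*-resp-≈ feed-layer ⟩∘⟨refl ⟩
          jumping                                                           ∎)
          where
            feed = [ id , inr ] ∘ ((id +₁ g) +₁ id)
            feed-layer : S.Tmap feed ∘ layer ≈ [ [ S.η ∘ inl , S.η ∘ inr ∘ g ] , S.Tmap inr ∘ υ.α ]
            feed-layer = trans≈ ∘[] ([]-cong₂
                (trans≈ SL.Tmap-η' (trans≈ (refl⟩∘⟨ trans≈ (pullʳ inject₁) (trans≈ (pullˡ inject₁) identityˡ))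
                  (trans≈ ∘[] ([]-cong₂ (refl⟩∘⟨ identityʳ) refl≈))))
                (trans≈ SL.Tmap∘Tmap∘ (SL.Tmap-resp (trans≈ (pullʳ inject₂) (trans≈ (pullˡ inject₂) identityʳ)) ⟩∘⟨refl)))

        ξ-iterate : (ξ₀ ∘ g) S.† ≈ jumping S.† ∘ g
        ξ-iterate = sym≈ (begin
          jumping S.† ∘ g                                              ≈⟨ S.†-resp-≈ jumping-ζ ⟩∘⟨refl ⟩
          (S.Tmap [ id , inr ] ∘ S.Tmap ((id +₁ g) +₁ id) ∘ ζ₀) S.† ∘ g ≈⟨ S.codiagonal ⟩∘⟨refl ⟩
          ((S.Tmap ((id +₁ g) +₁ id) ∘ ζ₀) S.†) S.† ∘ g                ≈⟨ S.†-resp-≈ (sym≈ SL.†-Tmap) ⟩∘⟨refl ⟩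
          (S.Tmap (id +₁ g) ∘ ξ₀) S.† ∘ g                              ≈⟨ S.uniformity assoc ⟩
          (ξ₀ ∘ g) S.†                                                 ∎)

        ξ-dagger : (ξ₀ ∘ g) S.† ≈ ξ₀ ∘ g M.†
        ξ-dagger = sym≈ (begin
          ξ₀ ∘ g M.†           ≈⟨ refl⟩∘⟨ sym≈ M.unfold-law ⟩
          ξ₀ ∘ resume M.* ∘ g  ≈⟨ pullˡ ξ-resume ⟩
          resolved S.† ∘ g     ≈⟨ SL.†-resolve-inner-loop ⟩∘⟨refl ⟩
          jumping S.† ∘ g      ≈⟨ sym≈ ξ-iterate ⟩
          (ξ₀ ∘ g) S.†         ∎)

      mediating : ElgotMorphism M S
      mediating = record
        { ξ = ξ₀ ; natural = ξ-natural ; unit = ξ-η ; bind = ξ-bind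
        ; strength = ξ-strength ; dagger = λ {_} {_} {g} → ξ-dagger g }

      module _ (ξ' : ElgotMorphism M S)
               (ξ'-ext : ∀ {X} → ElgotMorphism.ξ ξ' ∘ ext FC M {X} ≈ σ.ξ)
               (ξ'-ι : ∀ {X} → ElgotMorphism.ξ ξ' ∘ ι FC M {X} ≈ υ.α) where
        private module Ξ = ElgotMorphism ξ'

        ξ'-reconstruct : ∀ {X} → Ξ.ξ ∘ reconstruct ≈ ζ₀ {X}
        ξ'-reconstruct = begin
          Ξ.ξ ∘ [ M.η ∘ inl , ι FC M ∘ F₁ inr ] M.* ∘ ext FC M ∘ out     ≈⟨ trans≈ (pullˡ Ξ.bind) assoc ⟩
          (Ξ.ξ ∘ [ M.η ∘ inl , ι FC M ∘ F₁ inr ]) S.* ∘ Ξ.ξ ∘ ext FC M ∘ out ≈⟨ refl⟩∘⟨ pullˡ ξ'-ext ⟩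
          (Ξ.ξ ∘ [ M.η ∘ inl , ι FC M ∘ F₁ inr ]) S.* ∘ σ.ξ ∘ out       ≈⟨ S.*-resp-≈ ξ'-layer ⟩∘⟨refl ⟩
          layer S.* ∘ σ.ξ ∘ out                                         ∎
          where
            ξ'-layer : Ξ.ξ ∘ [ M.η ∘ inl , ι FC M ∘ F₁ inr ] ≈ layer
            ξ'-layer = trans≈ ∘[] ([]-cong₂ (pullˡ Ξ.unit) (trans≈ (pullˡ ξ'-ι) υ.natural))

        unique : ∀ {X} → Ξ.ξ ≈ ξ₀ {X}
        unique = begin
          Ξ.ξ                     ≈⟨ sym≈ (elimʳ reconstruct-†) ⟩
          Ξ.ξ ∘ reconstruct M.†   ≈⟨ sym≈ Ξ.dagger ⟩
          (Ξ.ξ ∘ reconstruct) S.† ≈⟨ S.†-resp-≈ ξ'-reconstruct ⟩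
          ξ₀                      ∎

theorem6p3 : ∀ {o ℓ e} (𝒟 : DistributiveCategory o ℓ e) → let open Over 𝒟 in
    {T₀ : Obj → Obj} (T : CompleteElgotMonadOn T₀) (Sig : StrongFunctor)
    (FC : FinalCoalgebras T Sig) (M : CompleteElgotMonadOn (FinalCoalgebras.TΣ FC))
    → IsCanonical FC M
    → {S₀ : Obj → Obj} (S : CompleteElgotMonadOn S₀)
      (υ : StrongNatTrans Sig S) (σ : ElgotMorphism T S)
    → Σ[ ξ ∈ ElgotMorphism M S ]
        ((∀ {X} → ElgotMorphism.ξ ξ ∘ ext FC M {X} ≈ ElgotMorphism.ξ σ)
        ∧ (∀ {X} → ElgotMorphism.ξ ξ ∘ ι FC M {X} ≈ StrongNatTrans.α υ)
        ∧ (∀ {X} → ElgotMorphism.ξ ξ {X}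
                     ≈ CompleteElgotMonadOn._† S (ζ FC M υ σ {X}))
        ∧ ((ξ' : ElgotMorphism M S)
           → (∀ {X} → ElgotMorphism.ξ ξ' ∘ ext FC M {X} ≈ ElgotMorphism.ξ σ)
           → (∀ {X} → ElgotMorphism.ξ ξ' ∘ ι FC M {X} ≈ StrongNatTrans.α υ)
           → ∀ {X} → ElgotMorphism.ξ ξ' {X} ≈ ElgotMorphism.ξ ξ {X}))
theorem6p3 𝒟 T Sig FC M can S υ σ =
  mediating , ξ-ext , ξ-ι , refl≈ , unique
  where
    open Toolkit 𝒟 using (refl≈)
    open Theory.Canonical 𝒟 T Sig FC M can
    open Mediating S υ σ
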